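{- The category $\mathbf{QMA}$ of quantum monadic algebras and their homomorphisms is isomorphic to the category $\mathbf{MQIA}$ of monadic quasi-implication algebras and their homomorphisms.
   Context: An ortholattice is a bounded lattice $\langle A;\wedge,\vee,0,1\rangle$ with a unary operation $^{\perp}$ such that $x\wedge x^{\perp}=0$, $x\vee x^{\perp}=1$, $x\le y\Rightarrow y^{\perp}\le x^{\perp}$, and $x^{\perp\perp}=x$. An orthomodular lattice is an ortholattice satisfying: $x\le y$ implies $y=x\vee(x^{\perp}\wedge y)$. A quantum monadic algebra is an orthomodular lattice with a unary operation $\exists$ satisfying for all $x,y$: $\exists 0=0$; $x\le\exists x$; $\exists(x\vee y)=\exists x\vee\exists y$; $\exists\exists x=\exists x$; $\exists((\exists x)^{\perp})=(\exists x)^{\perp}$. A homomorphism of quantum monadic algebras is a bounded lattice homomorphism $h$ with $h(x^{\perp})=h(x)^{\perp}$ and $h(\exists x)=\exists h(x)$. A quasi-implication algebra is a magma $\langle A;\cdot\rangle$ satisfying, for all $x,y,z$: (1) $(x\cdot y)\cdot x=x$; (2) $(x\cdot y)\cdot(x\cdot z)=(y\cdot x)\cdot(y\cdot z)$; (3) $((x\cdot y)\cdot(y\cdot x))\cdot x=((y\cdot x)\cdot(x\cdot y))\cdot y$. In any quasi-implication algebra $x\cdot x=y\cdot y$ for all $x,y$, and $1$ denotes this common element. A bounded quasi-implication algebra is a quasi-implication algebra with a distinguished element $0$ such that $0\cdot x=1$ for all $x$. A monadic quasi-implication algebra is an algebra $\langle A;\cdot,0,\Diamond\rangle$ such that $\langle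 A;\cdot,0\rangle$ is a bounded quasi-implication algebra and $\Diamond\colon A\to A$ satisfies, for all $x,y$: (a) $\Diamond\Diamond x\cdot\Diamond x=1$ and $x\cdot\Diamond x=1$; (b) $\Diamond(\Diamond x\cdot 0)=\Diamond x\cdot 0$ and $\Diamond 0=0$; (c) $\Diamond(((x\cdot 0)\cdot(y\cdot 0))\cdot x)=((\Diamond x\cdot 0)\cdot(\Diamond y\cdot 0))\cdot\Diamond x$. A homomorphism of monadic quasi-implication algebras is a map $h$ with $h(x\cdot y)=h(x)\cdot h(y)$, $h(0)=0$ and $h(\Diamond x)=\Diamond h(x)$. -}

module Defs where

open import Data.Product using (Σ; _×_; _,_)
open import Relation.Binary.PropositionalEquality using (_≡_)
open import Algebra.Core using (Op₁; Op₂)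
import Algebra.Lattice.Structures as LS
open import Data.Product using (proj₁)

record QMAOps (A : Set) : Set where
  field
    _∧_ _∨_ : Op₂ A
    𝟘 𝟙      : A
    _⊥       : Op₁ A
    ∃'       : Op₁ A

module _ {A : Set} (o : QMAOps A) where
  open QMAOps o

  _≤_ : A → A → Set
  x ≤ y = x ∧ y ≡ x

  record IsOrthoLattice : Set where
    field
      isLattice  : LS.IsLattice {A = A} _≡_ _∨_ _∧_
      bot        : ∀ x → 𝟘 ≤ x
      top        : ∀ x → x ≤ 𝟙
      compl-∧    : ∀ x → x ∧ (x ⊥) ≡ 𝟘
      compl-∨    : ∀ x → x ∨ (x ⊥) ≡ 𝟙
      antitone   : ∀ x y → x ≤ y → (y ⊥) ≤ (x ⊥)
      involutive : ∀ x → (x ⊥) ⊥ ≡ x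

  record IsOrthomodularLattice : Set where
    field
      isOrthoLattice : IsOrthoLattice
      orthomodular   : ∀ x y → x ≤ y → y ≡ x ∨ ((x ⊥) ∧ y)

  record IsQMA : Set where
    field
      isOML    : IsOrthomodularLattice
      ∃-0      : ∃' 𝟘 ≡ 𝟘
      ∃-incr   : ∀ x → x ≤ ∃' x
      ∃-∨      : ∀ x y → ∃' (x ∨ y) ≡ ∃' x ∨ ∃' y
      ∃-idem   : ∀ x → ∃' (∃' x) ≡ ∃' x
      ∃-compl  : ∀ x → ∃' ((∃' x) ⊥) ≡ (∃' x) ⊥

QMAStr : Set → Set
QMAStr A = Σ (QMAOps A) IsQMA

IsQMAHom : {A B : Set} → QMAOps A → QMAOps B → (A → B) → Set
IsQMAHom {A} oA oB h =
    (∀ x y → h (x A.∧ y) ≡ h x B.∧ h y)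
  × (∀ x y → h (x A.∨ y) ≡ h x B.∨ h y)
  × (h A.𝟘 ≡ B.𝟘)
  × (h A.𝟙 ≡ B.𝟙)
  × (∀ x → h (x A.⊥) ≡ (h x) B.⊥)
  × (∀ x → h (A.∃' x) ≡ B.∃' (h x))
  where
    module A = QMAOps oA
    module B = QMAOps oB

record MQIAOps (A : Set) : Set where
  field
    _·_ : Op₂ A
    𝟘   : A
    ◇   : Op₁ A

module _ {A : Set} (o : MQIAOps A) where
  open MQIAOps o

  record IsQIA : Set where
    field
      qia1 : ∀ x → ∀ y → (x · y) · x ≡ x
      qia2 : ∀ x y z → (x · y) · (x · z) ≡ (y · x) · (y · z)
      qia3 : ∀ x y → ((x · y) · (y · x)) · x ≡ ((y · x) · (x · y)) · y

  -- in a quasi-implication algebra x · x is constant; 1 is this element,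
  -- written here as 𝟘 · 𝟘
  𝟙 : A
  𝟙 = 𝟘 · 𝟘

  record IsBoundedQIA : Set where
    field
      isQIA : IsQIA
      bound : ∀ x → 𝟘 · x ≡ 𝟙

  record IsMQIA : Set where
    field
      isBQIA : IsBoundedQIA
      ◇a₁    : ∀ x → ◇ (◇ x) · ◇ x ≡ 𝟙
      ◇a₂    : ∀ x → x · ◇ x ≡ 𝟙
      ◇b₁    : ∀ x → ◇ (◇ x · 𝟘) ≡ ◇ x · 𝟘
      ◇b₂    : ◇ 𝟘 ≡ 𝟘
      ◇c     : ∀ x y → ◇ (((x · 𝟘) · (y · 𝟘)) · x)
                       ≡ ((◇ x · 𝟘) · (◇ y · 𝟘)) · ◇ x

MQIAStr : Set → Set
MQIAStr A = Σ (MQIAOps A) IsMQIA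

IsMQIAHom : {A B : Set} → MQIAOps A → MQIAOps B → (A → B) → Set
IsMQIAHom {A} oA oB h =
    (∀ x y → h (x A.· y) ≡ h x B.· h y)
  × (h A.𝟘 ≡ B.𝟘)
  × (∀ x → h (A.◇ x) ≡ B.◇ (h x))
  where
    module A = MQIAOps oA
    module B = MQIAOps oB

-- Pointwise equality of operation tuples (object equality in the
-- concrete categories over Set)

_≅QMA_ : {A : Set} → QMAOps A → QMAOps A → Set
o ≅QMA p =
    (∀ x y → x O.∧ y ≡ x P.∧ y)
  × (∀ x y → x O.∨ y ≡ x P.∨ y)
  × (O.𝟘 ≡ P.𝟘) × (O.𝟙 ≡ P.𝟙)
  × (∀ x → x O.⊥ ≡ x P.⊥)
  × (∀ x → O.∃' x ≡ P.∃' x)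
  where
    module O = QMAOps o
    module P = QMAOps p

_≅MQIA_ : {A : Set} → MQIAOps A → MQIAOps A → Set
o ≅MQIA p =
    (∀ x y → x O.· y ≡ x P.· y)
  × (O.𝟘 ≡ P.𝟘)
  × (∀ x → O.◇ x ≡ P.◇ x)
  where
    module O = MQIAOps o
    module P = MQIAOps p

-- An isomorphism between the concrete categories QMA and MQIA over Set:
-- object maps F, G acting on structures over the same carrier, mutually
-- inverse on objects, and acting as the identity on underlying maps,
-- which are homomorphisms on one side iff on the other (hence F, G are
-- mutually inverse functors).
record QMA≅MQIA : Set₁ where
  field
    F : ∀ {A} → QMAStr A → MQIAStr A
    G : ∀ {A} → MQIAStr A → QMAStr A
    GF : ∀ {A} (S : QMAStr A) → proj₁ (G (F S)) ≅QMA proj₁ S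
    FG : ∀ {A} (T : MQIAStr A) → proj₁ (F (G T)) ≅MQIA proj₁ T
    F-hom : ∀ {A B} (S : QMAStr A) (S' : QMAStr B) (h : A → B)
          → IsQMAHom (proj₁ S) (proj₁ S') h
          → IsMQIAHom (proj₁ (F S)) (proj₁ (F S')) h
    G-hom : ∀ {A B} (T : MQIAStr A) (T' : MQIAStr B) (h : A → B)
          → IsMQIAHom (proj₁ T) (proj₁ T') h
          → IsQMAHom (proj₁ (G T)) (proj₁ (G T')) h

module Submission where

-- An orthomodular lattice becomes a quasi-implication algebra under the Sasaki
-- hook x · y = x⊥ ∨ (x ∧ y): qia1 is orthomodularity, while qia2 and qia3 rest on
-- the Foulis–Holland distributive law for elements orthogonal to a common c.
-- Conversely, in a bounded quasi-implication algebra x · y = 1 is a partial order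
-- with orthocomplement x · 0 and meet ((x · y) · (x · 0)) · 0; it is an
-- orthomodular lattice whose Sasaki hook is again x · y. Under these dictionaries
-- the axioms of ∃ and of ◇ translate into each other, and since both translations
-- leave underlying maps alone, homomorphisms correspond as well.

open import Data.Product using (_,_; proj₁)
open import Relation.Binary.PropositionalEquality
open import Relation.Binary.Structures using (IsPartialOrder)
import Algebra.Lattice.Structures as AlgebraicLattice
import Algebra.Lattice.Bundles as AlgebraicLatticeBundles
import Algebra.Lattice.Properties.Lattice as AlgebraicLatticeProperties
import Relation.Binary.Lattice as OrderLattice
import Relation.Binary.Lattice.Properties.Lattice as OrderLatticeProperties
import Relation.Binary.Lattice.Properties.MeetSemilattice as MeetSemilatticeProperties
import Relation.Binary.Lattice.Properties.JoinSemilattice as JoinSemilatticeProperties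

open import Defs hiding (𝟙; _≤_)

module QuasiImplicationAlgebraProperties
  {A : Set} (o : MQIAOps A) (isQIA : IsQIA o) where

  open MQIAOps o using (_·_)
  open IsQIA isQIA
  open ≡-Reasoning

  x·[x·y]≡x·y : ∀ x y → x · (x · y) ≡ x · y
  x·[x·y]≡x·y x y = begin
    x · (x · y)              ≡⟨ cong (_· (x · y)) (qia1 x y) ⟨
    ((x · y) · x) · (x · y)  ≡⟨ qia1 (x · y) x ⟩
    x · y                    ∎

  [x·y]·[x·z]≡x·[[x·y]·z] : ∀ x y z → (x · y) · (x · z) ≡ x · ((x · y) · z)
  [x·y]·[x·z]≡x·[[x·y]·z] x y z = begin
    (x · y) · (x · z)              ≡⟨ cong (_· (x · z)) (x·[x·y]≡x·y x y) ⟨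
    (x · (x · y)) · (x · z)        ≡⟨ qia2 (x · y) x z ⟨
    ((x · y) · x) · ((x · y) · z)  ≡⟨ cong (_· ((x · y) · z)) (qia1 x y) ⟩
    x · ((x · y) · z)              ∎

  [[y·x]·[y·z]]·x≡x : ∀ x y z → ((y · x) · (y · z)) · x ≡ x
  [[y·x]·[y·z]]·x≡x x y z = begin
    ((y · x) · (y · z)) · x  ≡⟨ cong (_· x) (qia2 x y z) ⟨
    ((x · y) · (x · z)) · x  ≡⟨ cong (_· x) ([x·y]·[x·z]≡x·[[x·y]·z] x y z) ⟩
    (x · ((x · y) · z)) · x  ≡⟨ qia1 x ((x · y) · z) ⟩
    x                        ∎

  [x·x]·y≡y : ∀ x y → (x · x) · y ≡ y
  [x·x]·y≡y x y = begin
    (x · x) · y              ≡⟨ cong (λ t → (x · t) · y) (qia1 x y) ⟨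
    (x · ((x · y) · x)) · y  ≡⟨ cong (_· y) ([x·y]·[x·z]≡x·[[x·y]·z] x y x) ⟨
    ((x · y) · (x · x)) · y  ≡⟨ [[y·x]·[y·z]]·x≡x y x x ⟩
    y                        ∎

  -- Both x · x and y · y are left units, and qia3 forces two left units to agree.
  x·x≡y·y : ∀ x y → x · x ≡ y · y
  x·x≡y·y x y = begin
    e                           ≡⟨ [x·x]·y≡y x e ⟨
    e · e                       ≡⟨ cong (_· e) (trans (cong₂ _·_ e·e′≡e′ e′·e≡e) e′·e≡e) ⟨
    ((e · e′) · (e′ · e)) · e   ≡⟨ qia3 e e′ ⟩
    ((e′ · e) · (e · e′)) · e′  ≡⟨ cong (_· e′) (trans (cong₂ _·_ e′·e≡e e·e′≡e′) e·e′≡e′) ⟩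
    e′ · e′                     ≡⟨ [x·x]·y≡y y e′ ⟩
    e′                          ∎
    where
    e : A
    e = x · x
    e′ : A
    e′ = y · y
    e·e′≡e′ : e · e′ ≡ e′
    e·e′≡e′ = [x·x]·y≡y x e′
    e′·e≡e : e′ · e ≡ e
    e′·e≡e = [x·x]·y≡y y e

module BoundedQuasiImplicationAlgebraProperties
  {A : Set} (o : MQIAOps A) (isBQIA : IsBoundedQIA o) where

  open MQIAOps o using (_·_; 𝟘)
  open IsBoundedQIA isBQIA
  open IsQIA isQIA
  open QuasiImplicationAlgebraProperties o isQIA public
  open ≡-Reasoning

  infixr 25 ∼_
  infixr 7 _⊓_
  infixr 6 _⊔_
  infix 4 _⊑_

  𝟙 : A
  𝟙 = 𝟘 · 𝟘

  ∼_ : A → A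
  ∼ x = x · 𝟘

  _⊑_ : A → A → Set
  x ⊑ y = x · y ≡ 𝟙

  -- In an orthomodular lattice with the Sasaki hook, (x · y) · ∼ x is (x ∧ y)⊥.
  _⊓_ : A → A → A
  x ⊓ y = ∼ ((x · y) · ∼ x)

  _⊔_ : A → A → A
  x ⊔ y = ∼ (∼ x ⊓ ∼ y)

  x·x≡𝟙 : ∀ x → x · x ≡ 𝟙
  x·x≡𝟙 x = x·x≡y·y x 𝟘

  𝟙·x≡x : ∀ x → 𝟙 · x ≡ x
  𝟙·x≡x = [x·x]·y≡y 𝟘

  x·𝟙≡𝟙 : ∀ x → x · 𝟙 ≡ 𝟙
  x·𝟙≡𝟙 x = begin
    x · 𝟙          ≡⟨ cong (_· 𝟙) (𝟙·x≡x x) ⟨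
    (𝟙 · x) · 𝟙    ≡⟨ qia1 𝟙 x ⟩
    𝟙              ∎

  ∼∼x≡x : ∀ x → ∼ ∼ x ≡ x
  ∼∼x≡x x = begin
    ∼ ∼ x                     ≡⟨ cong (_· 𝟘) (𝟙·x≡x (∼ x)) ⟨
    (𝟙 · ∼ x) · 𝟘             ≡⟨ cong (λ t → (t · ∼ x) · 𝟘) (bound x) ⟨
    ((𝟘 · x) · ∼ x) · 𝟘       ≡⟨ qia3 x 𝟘 ⟨
    (∼ x · (𝟘 · x)) · x       ≡⟨ cong (λ t → (∼ x · t) · x) (bound x) ⟩
    (∼ x · 𝟙) · x             ≡⟨ cong (_· x) (x·𝟙≡𝟙 (∼ x)) ⟩
    𝟙 · x                     ≡⟨ 𝟙·x≡x x ⟩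
    x                         ∎

  ⊑-refl : ∀ x → x ⊑ x
  ⊑-refl = x·x≡𝟙

  ⊑-antisym : ∀ {x y} → x ⊑ y → y ⊑ x → x ≡ y
  ⊑-antisym {x} {y} x⊑y y⊑x = begin
    x                        ≡⟨ 𝟙·x≡x x ⟨
    𝟙 · x                    ≡⟨ cong (_· x) (trans (cong₂ _·_ x⊑y y⊑x) (x·x≡𝟙 𝟙)) ⟨
    ((x · y) · (y · x)) · x  ≡⟨ qia3 x y ⟩
    ((y · x) · (x · y)) · y  ≡⟨ cong (_· y) (trans (cong₂ _·_ y⊑x x⊑y) (x·x≡𝟙 𝟙)) ⟩
    𝟙 · y                    ≡⟨ 𝟙·x≡x y ⟩
    y                        ∎

  x⊑y⇒[x·z]·y≡y : ∀ {x y} → x ⊑ y → ∀ z → (x · z) · y ≡ y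
  x⊑y⇒[x·z]·y≡y {x} {y} x⊑y z = begin
    (x · z) · y              ≡⟨ cong (_· y) (𝟙·x≡x (x · z)) ⟨
    (𝟙 · (x · z)) · y        ≡⟨ cong (λ t → (t · (x · z)) · y) x⊑y ⟨
    ((x · y) · (x · z)) · y  ≡⟨ [[y·x]·[y·z]]·x≡x y x z ⟩
    y                        ∎

  x⊑y⇒y·[x·z]≡x·z : ∀ {x y} → x ⊑ y → ∀ z → y · (x · z) ≡ x · z
  x⊑y⇒y·[x·z]≡x·z {x} {y} x⊑y z = begin
    y · (x · z)              ≡⟨ cong (_· (x · z)) (x⊑y⇒[x·z]·y≡y x⊑y z) ⟨
    ((x · z) · y) · (x · z)  ≡⟨ qia1 (x · z) y ⟩
    x · z                    ∎

  ⊑-trans : ∀ {x y z} → x ⊑ y → y ⊑ z → x ⊑ z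
  ⊑-trans {x} {y} {z} x⊑y y⊑z = begin
    x · z                ≡⟨ cong (x ·_) [x·z]·z≡z ⟨
    x · ((x · z) · z)    ≡⟨ [x·y]·[x·z]≡x·[[x·y]·z] x z z ⟨
    (x · z) · (x · z)    ≡⟨ x·x≡𝟙 (x · z) ⟩
    𝟙                    ∎
    where
    [x·z]·z≡z : (x · z) · z ≡ z
    [x·z]·z≡z = begin
      (x · z) · z        ≡⟨ cong (_· z) (x⊑y⇒y·[x·z]≡x·z x⊑y z) ⟨
      (y · (x · z)) · z  ≡⟨ x⊑y⇒[x·z]·y≡y y⊑z (x · z) ⟩
      z                  ∎

  x⊑y⇒[y·x]·x≡y : ∀ {x y} → x ⊑ y → (y · x) · x ≡ y
  x⊑y⇒[y·x]·x≡y {x} {y} x⊑y = begin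
    (y · x) · x              ≡⟨ cong (_· x) (𝟙·x≡x (y · x)) ⟨
    (𝟙 · (y · x)) · x        ≡⟨ cong (λ t → (t · (y · x)) · x) x⊑y ⟨
    ((x · y) · (y · x)) · x  ≡⟨ qia3 y x ⟨
    ((y · x) · (x · y)) · y  ≡⟨ cong (λ t → ((y · x) · t) · y) x⊑y ⟩
    ((y · x) · 𝟙) · y        ≡⟨ cong (_· y) (x·𝟙≡𝟙 (y · x)) ⟩
    𝟙 · y                    ≡⟨ 𝟙·x≡x y ⟩
    y                        ∎

  x⊑y⇒x·z≡[y·x]·[y·z] : ∀ {x y} → x ⊑ y → ∀ z → x · z ≡ (y · x) · (y · z)
  x⊑y⇒x·z≡[y·x]·[y·z] {x} {y} x⊑y z = begin
    x · z              ≡⟨ 𝟙·x≡x (x · z) ⟨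
    𝟙 · (x · z)        ≡⟨ cong (_· (x · z)) x⊑y ⟨
    (x · y) · (x · z)  ≡⟨ qia2 x y z ⟩
    (y · x) · (y · z)  ∎

  ∼x⊑x·y : ∀ x y → ∼ x ⊑ x · y
  ∼x⊑x·y x y = begin
    ∼ x · (x · y)      ≡⟨ qia2 x 𝟘 y ⟩
    (𝟘 · x) · (𝟘 · y)  ≡⟨ cong₂ _·_ (bound x) (bound y) ⟩
    𝟙 · 𝟙              ≡⟨ x·x≡𝟙 𝟙 ⟩
    𝟙                  ∎

  ∼[x·y]⊑x : ∀ x y → ∼ (x · y) ⊑ x
  ∼[x·y]⊑x x y = subst (λ t → ∼ (x · y) ⊑ t) (qia1 x y) (∼x⊑x·y (x · y) x)

  ∼-antitone : ∀ {x y} → x ⊑ y → ∼ y ⊑ ∼ x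
  ∼-antitone {x} {y} x⊑y =
    subst (λ t → ∼ t ⊑ ∼ x) (x⊑y⇒[x·z]·y≡y x⊑y 𝟘) (∼[x·y]⊑x (∼ x) y)

  x·[[x·y]·∼x]≡[x·y]·∼x : ∀ x y → x · ((x · y) · ∼ x) ≡ (x · y) · ∼ x
  x·[[x·y]·∼x]≡[x·y]·∼x x y = begin
    x · ((x · y) · ∼ x)        ≡⟨ [x·y]·[x·z]≡x·[[x·y]·z] x y (∼ x) ⟨
    (x · y) · (x · ∼ x)        ≡⟨ cong ((x · y) ·_) (x·[x·y]≡x·y x 𝟘) ⟩
    (x · y) · ∼ x              ∎

  x⊓y≡∼[x·∼[x·y]] : ∀ x y → x ⊓ y ≡ ∼ (x · ∼ (x · y))
  x⊓y≡∼[x·∼[x·y]] x y = cong ∼_ ([x·y]·[x·z]≡x·[[x·y]·z] x y 𝟘)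

  ⊓-comm : ∀ x y → x ⊓ y ≡ y ⊓ x
  ⊓-comm x y = cong ∼_ (qia2 x y 𝟘)

  x⊓y⊑x : ∀ x y → x ⊓ y ⊑ x
  x⊓y⊑x x y = subst (_⊑ x) (sym (x⊓y≡∼[x·∼[x·y]] x y)) (∼[x·y]⊑x x (∼ (x · y)))

  x⊓y⊑y : ∀ x y → x ⊓ y ⊑ y
  x⊓y⊑y x y = subst (_⊑ y) (⊓-comm y x) (x⊓y⊑x y x)

  x·[x⊓y]≡x·y : ∀ x y → x · (x ⊓ y) ≡ x · y
  x·[x⊓y]≡x·y x y = begin
    x · (x ⊓ y)                ≡⟨ cong (x ·_) (x⊓y≡∼[x·∼[x·y]] x y) ⟩
    x · ∼ (x · ∼ (x · y))      ≡⟨ [x·y]·[x·z]≡x·[[x·y]·z] x (∼ (x · y)) 𝟘 ⟨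
    (x · ∼ (x · y)) · ∼ x      ≡⟨ cong (_· ∼ x) ([x·y]·[x·z]≡x·[[x·y]·z] x y 𝟘) ⟨
    ((x · y) · ∼ x) · ∼ x      ≡⟨ x⊑y⇒[y·x]·x≡y (∼x⊑x·y x y) ⟩
    x · y                      ∎

  [x⊓y]·z≡[x·y]·[x·z] : ∀ x y z → (x ⊓ y) · z ≡ (x · y) · (x · z)
  [x⊓y]·z≡[x·y]·[x·z] x y z = begin
    (x ⊓ y) · z                  ≡⟨ x⊑y⇒x·z≡[y·x]·[y·z] (x⊓y⊑x x y) z ⟩
    (x · (x ⊓ y)) · (x · z)      ≡⟨ cong (_· (x · z)) (x·[x⊓y]≡x·y x y) ⟩
    (x · y) · (x · z)            ∎

  x⊑y⇒y⊓x≡x : ∀ {x y} → x ⊑ y → y ⊓ x ≡ x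
  x⊑y⇒y⊓x≡x {x} {y} x⊑y =
    trans (cong ∼_ (sym (x⊑y⇒x·z≡[y·x]·[y·z] x⊑y 𝟘))) (∼∼x≡x x)

  x⊑y⇒x⊓y≡x : ∀ {x y} → x ⊑ y → x ⊓ y ≡ x
  x⊑y⇒x⊓y≡x {x} {y} x⊑y = trans (⊓-comm x y) (x⊑y⇒y⊓x≡x x⊑y)

  x⊓y≡x⇒x⊑y : ∀ {x y} → x ⊓ y ≡ x → x ⊑ y
  x⊓y≡x⇒x⊑y {x} {y} x⊓y≡x = subst (_⊑ y) x⊓y≡x (x⊓y⊑y x y)

  ⊓-greatest : ∀ {x y z} → z ⊑ x → z ⊑ y → z ⊑ x ⊓ y
  ⊓-greatest {x} {y} {z} z⊑x z⊑y = begin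
    z · (x ⊓ y)              ≡⟨ x⊑y⇒x·z≡[y·x]·[y·z] z⊑x (x ⊓ y) ⟩
    (x · z) · (x · (x ⊓ y))  ≡⟨ cong ((x · z) ·_) (x·[x⊓y]≡x·y x y) ⟩
    (x · z) · (x · y)        ≡⟨ [x⊓y]·z≡[x·y]·[x·z] x z y ⟨
    (x ⊓ z) · y              ≡⟨ cong (_· y) (x⊑y⇒y⊓x≡x z⊑x) ⟩
    z · y                    ≡⟨ z⊑y ⟩
    𝟙                        ∎

  x⊑x⊔y : ∀ x y → x ⊑ x ⊔ y
  x⊑x⊔y x y = subst (_⊑ x ⊔ y) (∼∼x≡x x) (∼-antitone (x⊓y⊑x (∼ x) (∼ y)))

  y⊑x⊔y : ∀ x y → y ⊑ x ⊔ y
  y⊑x⊔y x y = subst (_⊑ x ⊔ y) (∼∼x≡x y) (∼-antitone (x⊓y⊑y (∼ x) (∼ y)))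

  ⊔-least : ∀ {x y z} → x ⊑ z → y ⊑ z → x ⊔ y ⊑ z
  ⊔-least {x} {y} {z} x⊑z y⊑z =
    subst (x ⊔ y ⊑_) (∼∼x≡x z) (∼-antitone (⊓-greatest (∼-antitone x⊑z) (∼-antitone y⊑z)))

  ⊑-isPartialOrder : IsPartialOrder _≡_ _⊑_
  ⊑-isPartialOrder = record
    { isPreorder = record
      { isEquivalence = isEquivalence
      ; reflexive     = λ { {x} refl → ⊑-refl x }
      ; trans         = ⊑-trans
      }
    ; antisym    = ⊑-antisym
    }

  ⊑-lattice : OrderLattice.Lattice _ _ _
  ⊑-lattice = record
    { Carrier   = A
    ; _≈_       = _≡_
    ; _≤_       = _⊑_
    ; _∨_       = _⊔_
    ; _∧_       = _⊓_
    ; isLattice = record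
      { isPartialOrder = ⊑-isPartialOrder
      ; supremum       = λ x y → x⊑x⊔y x y , y⊑x⊔y x y , λ _ → ⊔-least
      ; infimum        = λ x y → x⊓y⊑x x y , x⊓y⊑y x y , λ _ → ⊓-greatest
      }
    }

  ⊔⊓-isLattice : AlgebraicLattice.IsLattice _≡_ _⊔_ _⊓_
  ⊔⊓-isLattice = OrderLatticeProperties.isAlgLattice ⊑-lattice

  x⊔y≡[∼x·∼y]·x : ∀ x y → x ⊔ y ≡ (∼ x · ∼ y) · x
  x⊔y≡[∼x·∼y]·x x y = trans (∼∼x≡x _) (cong ((∼ x · ∼ y) ·_) (∼∼x≡x x))

  x⊓∼x≡𝟘 : ∀ x → x ⊓ ∼ x ≡ 𝟘
  x⊓∼x≡𝟘 x = begin
    x ⊓ ∼ x            ≡⟨ cong (λ t → ∼ (t · ∼ x)) (x·[x·y]≡x·y x 𝟘) ⟩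
    ∼ (∼ x · ∼ x)      ≡⟨ cong ∼_ (x·x≡𝟙 (∼ x)) ⟩
    ∼ 𝟙                ≡⟨ 𝟙·x≡x 𝟘 ⟩
    𝟘                  ∎

  x⊔∼x≡𝟙 : ∀ x → x ⊔ ∼ x ≡ 𝟙
  x⊔∼x≡𝟙 x = cong ∼_ (x⊓∼x≡𝟘 (∼ x))

  x⊑y⇒x⊔[∼x⊓y]≡y : ∀ {x y} → x ⊑ y → x ⊔ (∼ x ⊓ y) ≡ y
  x⊑y⇒x⊔[∼x⊓y]≡y {x} {y} x⊑y = begin
    x ⊔ (∼ x ⊓ y)                    ≡⟨ x⊔y≡[∼x·∼y]·x x (∼ x ⊓ y) ⟩
    (∼ x · ∼ (∼ x ⊓ y)) · x          ≡⟨ cong (λ t → (∼ x · t) · x) (∼∼x≡x _) ⟩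
    (∼ x · ((∼ x · y) · ∼ ∼ x)) · x  ≡⟨ cong (_· x) (x·[[x·y]·∼x]≡[x·y]·∼x (∼ x) y) ⟩
    ((∼ x · y) · ∼ ∼ x) · x
      ≡⟨ cong₂ (λ s t → (s · t) · x) (x⊑y⇒[x·z]·y≡y x⊑y 𝟘) (∼∼x≡x x) ⟩
    (y · x) · x                      ≡⟨ x⊑y⇒[y·x]·x≡y x⊑y ⟩
    y                                ∎

  x·y≡∼x⊔[x⊓y] : ∀ x y → x · y ≡ ∼ x ⊔ (x ⊓ y)
  x·y≡∼x⊔[x⊓y] x y = sym (begin
    ∼ x ⊔ (x ⊓ y)                ≡⟨ x⊔y≡[∼x·∼y]·x (∼ x) (x ⊓ y) ⟩
    (∼ ∼ x · ∼ (x ⊓ y)) · ∼ x    ≡⟨ cong₂ (λ s t → (s · t) · ∼ x) (∼∼x≡x x) (∼∼x≡x _) ⟩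
    (x · ((x · y) · ∼ x)) · ∼ x  ≡⟨ cong (_· ∼ x) (x·[[x·y]·∼x]≡[x·y]·∼x x y) ⟩
    ((x · y) · ∼ x) · ∼ x        ≡⟨ x⊑y⇒[y·x]·x≡y (∼x⊑x·y x y) ⟩
    x · y                        ∎)

module MonadicQuasiImplicationAlgebraProperties
  {A : Set} (o : MQIAOps A) (isMQIA : IsMQIA o) where

  open MQIAOps o
  open IsMQIA isMQIA
  open IsBoundedQIA isBQIA using (bound)
  open BoundedQuasiImplicationAlgebraProperties o isBQIA public

  ◇-⊔ : ∀ x y → ◇ (x ⊔ y) ≡ ◇ x ⊔ ◇ y
  ◇-⊔ x y = begin
    ◇ (x ⊔ y)                ≡⟨ cong ◇ (x⊔y≡[∼x·∼y]·x x y) ⟩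
    ◇ ((∼ x · ∼ y) · x)      ≡⟨ ◇c x y ⟩
    (∼ ◇ x · ∼ ◇ y) · ◇ x    ≡⟨ x⊔y≡[∼x·∼y]·x (◇ x) (◇ y) ⟨
    ◇ x ⊔ ◇ y                ∎
    where open ≡-Reasoning

  ⊔⊓-qmaOps : QMAOps A
  ⊔⊓-qmaOps = record
    { _∧_ = _⊓_ ; _∨_ = _⊔_ ; 𝟘 = 𝟘 ; 𝟙 = 𝟙 ; _⊥ = ∼_ ; ∃' = ◇ }

  ⊔⊓-isQMA : IsQMA ⊔⊓-qmaOps
  ⊔⊓-isQMA = record
    { isOML   = record
      { isOrthoLattice = record
        { isLattice  = ⊔⊓-isLattice
        ; bot        = λ x → x⊑y⇒x⊓y≡x (bound x)
        ; top        = λ x → x⊑y⇒x⊓y≡x (x·𝟙≡𝟙 x)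
        ; compl-∧    = x⊓∼x≡𝟘
        ; compl-∨    = x⊔∼x≡𝟙
        ; antitone   = λ _ _ x≤y → x⊑y⇒x⊓y≡x (∼-antitone (x⊓y≡x⇒x⊑y x≤y))
        ; involutive = ∼∼x≡x
        }
      ; orthomodular = λ _ _ x≤y → sym (x⊑y⇒x⊔[∼x⊓y]≡y (x⊓y≡x⇒x⊑y x≤y))
      }
    ; ∃-0     = ◇b₂
    ; ∃-incr  = λ x → x⊑y⇒x⊓y≡x (◇a₂ x)
    ; ∃-∨     = ◇-⊔
    ; ∃-idem  = λ x → ⊑-antisym (◇a₁ x) (◇a₂ (◇ x))
    ; ∃-compl = ◇b₁
    }

module OrthomodularLatticeProperties
  {A : Set} (o : QMAOps A) (isOML : IsOrthomodularLattice o) where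

  open QMAOps o
  open IsOrthomodularLattice isOML
  open IsOrthoLattice isOrthoLattice
  open AlgebraicLattice.IsLattice isLattice using (∧-comm; ∨-comm; ∨-assoc; ∧-absorbs-∨)
  open ≡-Reasoning

  lattice : AlgebraicLatticeBundles.Lattice _ _
  lattice = record
    { Carrier = A ; _≈_ = _≡_ ; _∨_ = _∨_ ; _∧_ = _∧_ ; isLattice = isLattice }

  -- The library's order is the left natural one, x ≤ y = (x ≡ x ∧ y), whereas
  -- Defs states x ∧ y ≡ x; hence the sym's when moving between the two.
  open OrderLattice.Lattice (AlgebraicLatticeProperties.∨-∧-orderTheoreticLattice lattice) public
    using ( _≤_; reflexive; antisym; x≤x∨y; y≤x∨y; ∨-least; x∧y≤x; x∧y≤y; ∧-greatest
          ; meetSemilattice; joinSemilattice )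
    renaming (trans to ≤-trans)
  open MeetSemilatticeProperties meetSemilattice using (∧-monotonic)
  open JoinSemilatticeProperties joinSemilattice using (x≤y⇒x∨y≈y)

  𝟘≤x : ∀ x → 𝟘 ≤ x
  𝟘≤x x = sym (bot x)

  ≤𝟘⇒≡𝟘 : ∀ {x} → x ≤ 𝟘 → x ≡ 𝟘
  ≤𝟘⇒≡𝟘 x≤𝟘 = antisym x≤𝟘 (𝟘≤x _)

  x∨𝟘≡x : ∀ x → x ∨ 𝟘 ≡ x
  x∨𝟘≡x x = trans (∨-comm x 𝟘) (x≤y⇒x∨y≈y (𝟘≤x x))

  x∧𝟘≡𝟘 : ∀ x → x ∧ 𝟘 ≡ 𝟘
  x∧𝟘≡𝟘 x = trans (∧-comm x 𝟘) (bot x)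

  𝟘⊥≡𝟙 : 𝟘 ⊥ ≡ 𝟙
  𝟘⊥≡𝟙 = trans (sym (x≤y⇒x∨y≈y (𝟘≤x (𝟘 ⊥)))) (compl-∨ 𝟘)

  ⊥-antitone : ∀ {x y} → x ≤ y → y ⊥ ≤ x ⊥
  ⊥-antitone {x} {y} x≤y = sym (antitone x y (sym x≤y))

  x≤y⊥⇒y≤x⊥ : ∀ {x y} → x ≤ y ⊥ → y ≤ x ⊥
  x≤y⊥⇒y≤x⊥ {x} {y} x≤y⊥ = subst (_≤ x ⊥) (involutive y) (⊥-antitone x≤y⊥)

  ⊥-∨ : ∀ x y → (x ∨ y) ⊥ ≡ (x ⊥) ∧ (y ⊥)
  ⊥-∨ x y = antisym
    (∧-greatest (⊥-antitone (x≤x∨y x y)) (⊥-antitone (y≤x∨y x y)))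
    (x≤y⊥⇒y≤x⊥ (∨-least (x≤y⊥⇒y≤x⊥ (x∧y≤x (x ⊥) (y ⊥))) (x≤y⊥⇒y≤x⊥ (x∧y≤y (x ⊥) (y ⊥)))))

  ⊥-∧ : ∀ x y → (x ∧ y) ⊥ ≡ (x ⊥) ∨ (y ⊥)
  ⊥-∧ x y = begin
    (x ∧ y) ⊥                    ≡⟨ cong₂ (λ a b → (a ∧ b) ⊥) (involutive x) (involutive y) ⟨
    (((x ⊥) ⊥) ∧ ((y ⊥) ⊥)) ⊥    ≡⟨ cong _⊥ (⊥-∨ (x ⊥) (y ⊥)) ⟨
    (((x ⊥) ∨ (y ⊥)) ⊥) ⊥        ≡⟨ involutive _ ⟩
    (x ⊥) ∨ (y ⊥)                ∎

  orthomodular-∨ : ∀ {x y} → x ≤ y → x ∨ ((x ⊥) ∧ y) ≡ y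
  orthomodular-∨ {x} {y} x≤y = sym (orthomodular x y (sym x≤y))

  orthomodular-∨ʳ : ∀ {x y} → x ≤ y → ((x ⊥) ∧ y) ∨ x ≡ y
  orthomodular-∨ʳ {x} {y} x≤y = trans (∨-comm _ x) (orthomodular-∨ x≤y)

  orthomodular-∧ : ∀ {x y} → x ≤ y → y ∧ ((y ⊥) ∨ x) ≡ x
  orthomodular-∧ {x} {y} x≤y = begin
    y ∧ ((y ⊥) ∨ x)
      ≡⟨ cong₂ (λ a b → a ∧ ((a ⊥) ∨ b)) (involutive y) (involutive x) ⟨
    (y ⊥ ⊥) ∧ ((y ⊥ ⊥ ⊥) ∨ (x ⊥ ⊥))
      ≡⟨ cong ((y ⊥ ⊥) ∧_) (⊥-∧ (y ⊥ ⊥) (x ⊥)) ⟨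
    (y ⊥ ⊥) ∧ (((y ⊥ ⊥) ∧ (x ⊥)) ⊥)
      ≡⟨ ⊥-∨ (y ⊥) _ ⟨
    ((y ⊥) ∨ ((y ⊥ ⊥) ∧ (x ⊥))) ⊥
      ≡⟨ cong _⊥ (orthomodular-∨ (⊥-antitone x≤y)) ⟩
    x ⊥ ⊥
      ≡⟨ involutive x ⟩
    x ∎

  orthomodular-antisym : ∀ {x y} → x ≤ y → (x ⊥) ∧ y ≤ 𝟘 → x ≡ y
  orthomodular-antisym {x} {y} x≤y x⊥∧y≤𝟘 = begin
    x                  ≡⟨ x∨𝟘≡x x ⟨
    x ∨ 𝟘              ≡⟨ cong (x ∨_) (≤𝟘⇒≡𝟘 x⊥∧y≤𝟘) ⟨
    x ∨ ((x ⊥) ∧ y)    ≡⟨ orthomodular-∨ x≤y ⟩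
    y                  ∎

  foulis-holland : ∀ {c p q} → p ≤ c ⊥ → q ≤ c ⊥ → c ∨ (p ∧ q) ≡ (c ∨ p) ∧ (c ∨ q)
  foulis-holland {c} {p} {q} p≤c⊥ q≤c⊥ = orthomodular-antisym r≤s r⊥∧s≤𝟘
    where
    r : A
    r = c ∨ (p ∧ q)
    s : A
    s = (c ∨ p) ∧ (c ∨ q)
    r≤s : r ≤ s
    r≤s = ∨-least (∧-greatest (x≤x∨y c p) (x≤x∨y c q))
                  (∧-monotonic (y≤x∨y c p) (y≤x∨y c q))
    r⊥≤c⊥ : r ⊥ ≤ c ⊥
    r⊥≤c⊥ = ⊥-antitone (x≤x∨y c (p ∧ q))
    c⊥∧[c∨x]≡x : ∀ {x} → x ≤ c ⊥ → (c ⊥) ∧ (c ∨ x) ≡ x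
    c⊥∧[c∨x]≡x {x} x≤c⊥ =
      trans (cong (λ a → (c ⊥) ∧ (a ∨ x)) (sym (involutive c))) (orthomodular-∧ x≤c⊥)
    r⊥∧s≤p : (r ⊥) ∧ s ≤ p
    r⊥∧s≤p = subst ((r ⊥) ∧ s ≤_) (c⊥∧[c∨x]≡x p≤c⊥) (∧-monotonic r⊥≤c⊥ (x∧y≤x _ _))
    r⊥∧s≤q : (r ⊥) ∧ s ≤ q
    r⊥∧s≤q = subst ((r ⊥) ∧ s ≤_) (c⊥∧[c∨x]≡x q≤c⊥) (∧-monotonic r⊥≤c⊥ (x∧y≤y _ _))
    r⊥∧s≤[p∧q]⊥ : (r ⊥) ∧ s ≤ (p ∧ q) ⊥
    r⊥∧s≤[p∧q]⊥ = ≤-trans (x∧y≤x _ _) (⊥-antitone (y≤x∨y c (p ∧ q)))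
    r⊥∧s≤𝟘 : (r ⊥) ∧ s ≤ 𝟘
    r⊥∧s≤𝟘 = subst ((r ⊥) ∧ s ≤_) (compl-∧ (p ∧ q))
                   (∧-greatest (∧-greatest r⊥∧s≤p r⊥∧s≤q) r⊥∧s≤[p∧q]⊥)

  _⊃_ : A → A → A
  x ⊃ y = (x ⊥) ∨ (x ∧ y)

  ⊃-⊥ : ∀ x y → (x ⊃ y) ⊥ ≡ ((x ∧ y) ⊥) ∧ x
  ⊃-⊥ x y = trans (⊥-∨ (x ⊥) (x ∧ y)) (trans (∧-comm _ _) (cong (((x ∧ y) ⊥) ∧_) (involutive x)))

  x⊃𝟘≡x⊥ : ∀ x → x ⊃ 𝟘 ≡ x ⊥
  x⊃𝟘≡x⊥ x = trans (cong ((x ⊥) ∨_) (x∧𝟘≡𝟘 x)) (x∨𝟘≡x (x ⊥))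

  𝟘⊃𝟘≡𝟙 : 𝟘 ⊃ 𝟘 ≡ 𝟙
  𝟘⊃𝟘≡𝟙 = trans (x⊃𝟘≡x⊥ 𝟘) 𝟘⊥≡𝟙

  x≤y⇒x⊃y≡𝟘⊃𝟘 : ∀ {x y} → x ≤ y → x ⊃ y ≡ 𝟘 ⊃ 𝟘
  x≤y⇒x⊃y≡𝟘⊃𝟘 {x} {y} x≤y = begin
    (x ⊥) ∨ (x ∧ y)   ≡⟨ cong ((x ⊥) ∨_) x≤y ⟨
    (x ⊥) ∨ x         ≡⟨ ∨-comm (x ⊥) x ⟩
    x ∨ (x ⊥)         ≡⟨ compl-∨ x ⟩
    𝟙                 ≡⟨ 𝟘⊃𝟘≡𝟙 ⟨
    𝟘 ⊃ 𝟘             ∎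

  [x⊃y]⊃x≡x : ∀ x y → (x ⊃ y) ⊃ x ≡ x
  [x⊃y]⊃x≡x x y = begin
    ((x ⊃ y) ⊥) ∨ ((x ⊃ y) ∧ x)   ≡⟨ cong₂ _∨_ (⊃-⊥ x y) (∧-comm (x ⊃ y) x) ⟩
    ((m ⊥) ∧ x) ∨ (x ∧ (x ⊃ y))   ≡⟨ cong (((m ⊥) ∧ x) ∨_) (orthomodular-∧ (x∧y≤x x y)) ⟩
    ((m ⊥) ∧ x) ∨ m               ≡⟨ orthomodular-∨ʳ (x∧y≤x x y) ⟩
    x                             ∎
    where
    m : A
    m = x ∧ y

  [x∧y]∧[x∧z]≡[x∧y]∧z : ∀ x y z → (x ∧ y) ∧ (x ∧ z) ≡ (x ∧ y) ∧ z
  [x∧y]∧[x∧z]≡[x∧y]∧z x y z = antisym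
    (∧-greatest (x∧y≤x _ _) (≤-trans (x∧y≤y _ _) (x∧y≤y _ _)))
    (∧-greatest (x∧y≤x _ _) (∧-greatest (≤-trans (x∧y≤x _ _) (x∧y≤x _ _)) (x∧y≤y _ _)))

  [x⊃y]⊃[x⊃z]≡[x∧y]⊃z : ∀ x y z → (x ⊃ y) ⊃ (x ⊃ z) ≡ (x ∧ y) ⊃ z
  [x⊃y]⊃[x⊃z]≡[x∧y]⊃z x y z = begin
    ((x ⊃ y) ⊥) ∨ ((x ⊃ y) ∧ (x ⊃ z))
      ≡⟨ cong₂ _∨_ (⊃-⊥ x y) (sym (foulis-holland x∧y≤x⊥⊥ x∧z≤x⊥⊥)) ⟩
    ((m ⊥) ∧ x) ∨ ((x ⊥) ∨ (m ∧ (x ∧ z)))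
      ≡⟨ ∨-assoc _ _ _ ⟨
    (((m ⊥) ∧ x) ∨ (x ⊥)) ∨ (m ∧ (x ∧ z))
      ≡⟨ cong₂ _∨_ m⊥∧x∨x⊥≡m⊥ ([x∧y]∧[x∧z]≡[x∧y]∧z x y z) ⟩
    (m ⊥) ∨ (m ∧ z) ∎
    where
    m : A
    m = x ∧ y
    x∧y≤x⊥⊥ : x ∧ y ≤ x ⊥ ⊥
    x∧y≤x⊥⊥ = subst (x ∧ y ≤_) (sym (involutive x)) (x∧y≤x x y)
    x∧z≤x⊥⊥ : x ∧ z ≤ x ⊥ ⊥
    x∧z≤x⊥⊥ = subst (x ∧ z ≤_) (sym (involutive x)) (x∧y≤x x z)
    m⊥∧x∨x⊥≡m⊥ : ((m ⊥) ∧ x) ∨ (x ⊥) ≡ m ⊥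
    m⊥∧x∨x⊥≡m⊥ = begin
      ((m ⊥) ∧ x) ∨ (x ⊥)          ≡⟨ cong (λ a → ((m ⊥) ∧ a) ∨ (x ⊥)) (involutive x) ⟨
      ((m ⊥) ∧ (x ⊥ ⊥)) ∨ (x ⊥)    ≡⟨ cong (_∨ (x ⊥)) (∧-comm (m ⊥) (x ⊥ ⊥)) ⟩
      ((x ⊥ ⊥) ∧ (m ⊥)) ∨ (x ⊥)    ≡⟨ orthomodular-∨ʳ (⊥-antitone (x∧y≤x x y)) ⟩
      m ⊥                          ∎

  [x⊃y]⊃[y⊃x]≡x∨[x⊥∧y⊥] : ∀ x y → (x ⊃ y) ⊃ (y ⊃ x) ≡ x ∨ ((x ⊥) ∧ (y ⊥))
  [x⊃y]⊃[y⊃x]≡x∨[x⊥∧y⊥] x y = begin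
    ((x ⊃ y) ⊥) ∨ ((x ⊃ y) ∧ (y ⊃ x))
      ≡⟨ cong₂ _∨_ (⊃-⊥ x y) [x⊃y]∧[y⊃x]≡m∨[x⊥∧y⊥] ⟩
    ((m ⊥) ∧ x) ∨ (m ∨ ((x ⊥) ∧ (y ⊥)))
      ≡⟨ ∨-assoc _ _ _ ⟨
    (((m ⊥) ∧ x) ∨ m) ∨ ((x ⊥) ∧ (y ⊥))
      ≡⟨ cong (_∨ ((x ⊥) ∧ (y ⊥))) (orthomodular-∨ʳ (x∧y≤x x y)) ⟩
    x ∨ ((x ⊥) ∧ (y ⊥)) ∎
    where
    m : A
    m = x ∧ y
    [x⊃y]∧[y⊃x]≡m∨[x⊥∧y⊥] : (x ⊃ y) ∧ (y ⊃ x) ≡ m ∨ ((x ⊥) ∧ (y ⊥))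
    [x⊃y]∧[y⊃x]≡m∨[x⊥∧y⊥] = begin
      ((x ⊥) ∨ m) ∧ ((y ⊥) ∨ (y ∧ x))  ≡⟨ cong (λ a → ((x ⊥) ∨ m) ∧ ((y ⊥) ∨ a)) (∧-comm y x) ⟩
      ((x ⊥) ∨ m) ∧ ((y ⊥) ∨ m)        ≡⟨ cong₂ _∧_ (∨-comm (x ⊥) m) (∨-comm (y ⊥) m) ⟩
      (m ∨ (x ⊥)) ∧ (m ∨ (y ⊥))
        ≡⟨ foulis-holland (⊥-antitone (x∧y≤x x y)) (⊥-antitone (x∧y≤y x y)) ⟨
      m ∨ ((x ⊥) ∧ (y ⊥))              ∎

  [x∨[x⊥∧y⊥]]⊃x≡x∨y : ∀ x y → (x ∨ ((x ⊥) ∧ (y ⊥))) ⊃ x ≡ x ∨ y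
  [x∨[x⊥∧y⊥]]⊃x≡x∨y x y = begin
    ((x ∨ w) ⊥) ∨ ((x ∨ w) ∧ x)     ≡⟨ cong₂ _∨_ (⊥-∨ x w) (trans (∧-comm _ x) (∧-absorbs-∨ x w)) ⟩
    ((x ⊥) ∧ (w ⊥)) ∨ x             ≡⟨ cong (λ a → ((x ⊥) ∧ a) ∨ x) w⊥≡x∨y ⟩
    ((x ⊥) ∧ (x ∨ y)) ∨ x           ≡⟨ orthomodular-∨ʳ (x≤x∨y x y) ⟩
    x ∨ y                           ∎
    where
    w : A
    w = (x ⊥) ∧ (y ⊥)
    w⊥≡x∨y : w ⊥ ≡ x ∨ y
    w⊥≡x∨y = trans (⊥-∧ (x ⊥) (y ⊥)) (cong₂ _∨_ (involutive x) (involutive y))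

  ⊃-qia2 : ∀ x y z → (x ⊃ y) ⊃ (x ⊃ z) ≡ (y ⊃ x) ⊃ (y ⊃ z)
  ⊃-qia2 x y z = begin
    (x ⊃ y) ⊃ (x ⊃ z)    ≡⟨ [x⊃y]⊃[x⊃z]≡[x∧y]⊃z x y z ⟩
    (x ∧ y) ⊃ z          ≡⟨ cong (_⊃ z) (∧-comm x y) ⟩
    (y ∧ x) ⊃ z          ≡⟨ [x⊃y]⊃[x⊃z]≡[x∧y]⊃z y x z ⟨
    (y ⊃ x) ⊃ (y ⊃ z)    ∎

  ⊃-qia3 : ∀ x y → ((x ⊃ y) ⊃ (y ⊃ x)) ⊃ x ≡ ((y ⊃ x) ⊃ (x ⊃ y)) ⊃ y
  ⊃-qia3 x y = begin
    ((x ⊃ y) ⊃ (y ⊃ x)) ⊃ x      ≡⟨ cong (_⊃ x) ([x⊃y]⊃[y⊃x]≡x∨[x⊥∧y⊥] x y) ⟩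
    (x ∨ ((x ⊥) ∧ (y ⊥))) ⊃ x    ≡⟨ [x∨[x⊥∧y⊥]]⊃x≡x∨y x y ⟩
    x ∨ y                        ≡⟨ ∨-comm x y ⟩
    y ∨ x                        ≡⟨ [x∨[x⊥∧y⊥]]⊃x≡x∨y y x ⟨
    (y ∨ ((y ⊥) ∧ (x ⊥))) ⊃ y    ≡⟨ cong (_⊃ y) ([x⊃y]⊃[y⊃x]≡x∨[x⊥∧y⊥] y x) ⟨
    ((y ⊃ x) ⊃ (x ⊃ y)) ⊃ y      ∎

  [[x⊃y]⊃[x⊃𝟘]]⊃𝟘≡x∧y : ∀ x y → ((x ⊃ y) ⊃ (x ⊃ 𝟘)) ⊃ 𝟘 ≡ x ∧ y
  [[x⊃y]⊃[x⊃𝟘]]⊃𝟘≡x∧y x y = begin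
    ((x ⊃ y) ⊃ (x ⊃ 𝟘)) ⊃ 𝟘    ≡⟨ x⊃𝟘≡x⊥ _ ⟩
    ((x ⊃ y) ⊃ (x ⊃ 𝟘)) ⊥      ≡⟨ cong _⊥ ([x⊃y]⊃[x⊃z]≡[x∧y]⊃z x y 𝟘) ⟩
    ((x ∧ y) ⊃ 𝟘) ⊥            ≡⟨ cong _⊥ (x⊃𝟘≡x⊥ (x ∧ y)) ⟩
    (x ∧ y) ⊥ ⊥                ≡⟨ involutive (x ∧ y) ⟩
    x ∧ y                      ∎

  [[x⊃𝟘]⊃[y⊃𝟘]]⊃x≡x∨y : ∀ x y → ((x ⊃ 𝟘) ⊃ (y ⊃ 𝟘)) ⊃ x ≡ x ∨ y
  [[x⊃𝟘]⊃[y⊃𝟘]]⊃x≡x∨y x y = begin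
    ((x ⊃ 𝟘) ⊃ (y ⊃ 𝟘)) ⊃ x     ≡⟨ cong (λ a → (a ⊃ (y ⊃ 𝟘)) ⊃ x) (x⊃𝟘≡x⊥ x) ⟩
    ((x ⊥) ⊃ (y ⊃ 𝟘)) ⊃ x       ≡⟨ cong (λ a → ((x ⊥) ⊃ a) ⊃ x) (x⊃𝟘≡x⊥ y) ⟩
    ((x ⊥) ⊃ (y ⊥)) ⊃ x         ≡⟨ cong (λ a → (a ∨ ((x ⊥) ∧ (y ⊥))) ⊃ x) (involutive x) ⟩
    (x ∨ ((x ⊥) ∧ (y ⊥))) ⊃ x   ≡⟨ [x∨[x⊥∧y⊥]]⊃x≡x∨y x y ⟩
    x ∨ y                       ∎

module QuantumMonadicAlgebraProperties
  {A : Set} (o : QMAOps A) (isQMA : IsQMA o) where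

  open QMAOps o
  open IsQMA isQMA
  open OrthomodularLatticeProperties o isOML public

  ⊃-mqiaOps : MQIAOps A
  ⊃-mqiaOps = record { _·_ = _⊃_ ; 𝟘 = 𝟘 ; ◇ = ∃' }

  ∃[∃x⊃𝟘]≡∃x⊃𝟘 : ∀ x → ∃' (∃' x ⊃ 𝟘) ≡ ∃' x ⊃ 𝟘
  ∃[∃x⊃𝟘]≡∃x⊃𝟘 x = trans (cong ∃' (x⊃𝟘≡x⊥ (∃' x))) (trans (∃-compl x) (sym (x⊃𝟘≡x⊥ (∃' x))))

  ∃-⊃-join : ∀ x y → ∃' (((x ⊃ 𝟘) ⊃ (y ⊃ 𝟘)) ⊃ x) ≡ ((∃' x ⊃ 𝟘) ⊃ (∃' y ⊃ 𝟘)) ⊃ ∃' x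
  ∃-⊃-join x y = begin
    ∃' (((x ⊃ 𝟘) ⊃ (y ⊃ 𝟘)) ⊃ x)              ≡⟨ cong ∃' ([[x⊃𝟘]⊃[y⊃𝟘]]⊃x≡x∨y x y) ⟩
    ∃' (x ∨ y)                                ≡⟨ ∃-∨ x y ⟩
    ∃' x ∨ ∃' y                               ≡⟨ [[x⊃𝟘]⊃[y⊃𝟘]]⊃x≡x∨y (∃' x) (∃' y) ⟨
    ((∃' x ⊃ 𝟘) ⊃ (∃' y ⊃ 𝟘)) ⊃ ∃' x          ∎
    where open ≡-Reasoning

  ⊃-isMQIA : IsMQIA ⊃-mqiaOps
  ⊃-isMQIA = record
    { isBQIA = record
      { isQIA = record
        { qia1 = [x⊃y]⊃x≡x
        ; qia2 = ⊃-qia2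
        ; qia3 = ⊃-qia3
        }
      ; bound = λ x → x≤y⇒x⊃y≡𝟘⊃𝟘 (𝟘≤x x)
      }
    ; ◇a₁ = λ x → x≤y⇒x⊃y≡𝟘⊃𝟘 (reflexive (∃-idem x))
    ; ◇a₂ = λ x → x≤y⇒x⊃y≡𝟘⊃𝟘 (sym (∃-incr x))
    ; ◇b₁ = ∃[∃x⊃𝟘]≡∃x⊃𝟘
    ; ◇b₂ = ∃-0
    ; ◇c  = ∃-⊃-join
    }

toMQIA : ∀ {A} → QMAStr A → MQIAStr A
toMQIA (o , isQMA) = ⊃-mqiaOps , ⊃-isMQIA
  where open QuantumMonadicAlgebraProperties o isQMA

toQMA : ∀ {A} → MQIAStr A → QMAStr A
toQMA (o , isMQIA) = ⊔⊓-qmaOps , ⊔⊓-isQMA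
  where open MonadicQuasiImplicationAlgebraProperties o isMQIA

toQMA∘toMQIA≅id : ∀ {A} (S : QMAStr A) → proj₁ (toQMA (toMQIA S)) ≅QMA proj₁ S
toQMA∘toMQIA≅id (o , isQMA) =
  [[x⊃y]⊃[x⊃𝟘]]⊃𝟘≡x∧y , ⊔≡∨ , refl , 𝟘⊃𝟘≡𝟙 , x⊃𝟘≡x⊥ , λ _ → refl
  where
  open QMAOps o
  open QuantumMonadicAlgebraProperties o isQMA
  open MonadicQuasiImplicationAlgebraProperties ⊃-mqiaOps ⊃-isMQIA using (_⊔_; x⊔y≡[∼x·∼y]·x)
  ⊔≡∨ : ∀ x y → x ⊔ y ≡ x ∨ y
  ⊔≡∨ x y = trans (x⊔y≡[∼x·∼y]·x x y) ([[x⊃𝟘]⊃[y⊃𝟘]]⊃x≡x∨y x y)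

toMQIA∘toQMA≅id : ∀ {A} (T : MQIAStr A) → proj₁ (toMQIA (toQMA T)) ≅MQIA proj₁ T
toMQIA∘toQMA≅id (o , isMQIA) = (λ x y → sym (x·y≡∼x⊔[x⊓y] x y)) , refl , λ _ → refl
  where open MonadicQuasiImplicationAlgebraProperties o isMQIA

toMQIA-hom : ∀ {A B} (S : QMAStr A) (S′ : QMAStr B) (h : A → B)
           → IsQMAHom (proj₁ S) (proj₁ S′) h
           → IsMQIAHom (proj₁ (toMQIA S)) (proj₁ (toMQIA S′)) h
toMQIA-hom (o , _) (o′ , _) h (h-∧ , h-∨ , h-𝟘 , _ , h-⊥ , h-∃) = h-⊃ , h-𝟘 , h-∃
  where
  open QMAOps o
  module B = QMAOps o′
  h-⊃ : ∀ x y → h ((x ⊥) ∨ (x ∧ y)) ≡ (h x B.⊥) B.∨ (h x B.∧ h y)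
  h-⊃ x y = trans (h-∨ _ _) (cong₂ B._∨_ (h-⊥ x) (h-∧ x y))

toQMA-hom : ∀ {A B} (T : MQIAStr A) (T′ : MQIAStr B) (h : A → B)
          → IsMQIAHom (proj₁ T) (proj₁ T′) h
          → IsQMAHom (proj₁ (toQMA T)) (proj₁ (toQMA T′)) h
toQMA-hom (o , isMQIA) (o′ , isMQIA′) h (h-· , h-𝟘 , h-◇) = h-⊓ , h-⊔ , h-𝟘 , h-𝟙 , h-∼ , h-◇
  where
  open MQIAOps o using (𝟘)
  module S = MonadicQuasiImplicationAlgebraProperties o isMQIA
  module T = MonadicQuasiImplicationAlgebraProperties o′ isMQIA′
  open MQIAOps o′ using () renaming (_·_ to _·′_)
  h-∼ : ∀ x → h (S.∼ x) ≡ T.∼ h x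
  h-∼ x = trans (h-· x 𝟘) (cong (h x ·′_) h-𝟘)
  h-⊓ : ∀ x y → h (x S.⊓ y) ≡ h x T.⊓ h y
  h-⊓ x y = trans (h-∼ _) (cong T.∼_ (trans (h-· _ _) (cong₂ _·′_ (h-· x y) (h-∼ x))))
  h-𝟙 : h S.𝟙 ≡ T.𝟙
  h-𝟙 = trans (h-∼ 𝟘) (cong T.∼_ h-𝟘)
  h-⊔ : ∀ x y → h (x S.⊔ y) ≡ h x T.⊔ h y
  h-⊔ x y = trans (h-∼ _) (cong T.∼_ (trans (h-⊓ _ _) (cong₂ T._⊓_ (h-∼ x) (h-∼ y))))

theorem4p10 : QMA≅MQIA
theorem4p10 = record
  { F     = toMQIA
  ; G     = toQMA
  ; GF    = toQMA∘toMQIA≅id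
  ; FG    = toMQIA∘toQMA≅id
  ; F-hom = toMQIA-hom
  ; G-hom = toQMA-hom
  }
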